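{- For every positive integer $h$, the distance spectral radius of the multiplicative circulant graph $MC(2^h)$ is $$\rho(MC(2^h))=\frac{2^h(3h+1)-(-1)^h}{9}.$$
   Context: For integers $m>1$, $h>0$, $MC(m^h)$ is the graph with vertex set $\mathbb{Z}_{m^h}$ in which distinct vertices $x,y$ are adjacent iff $x-y\equiv \pm m^i \pmod{m^h}$ for some $i\in\{0,\ldots,h-1\}$. The distance spectral radius of a graph is the largest eigenvalue of its distance matrix $[d(v_i,v_j)]$ of shortest-path distances. -}

module Defs where

open import Level using (Level; suc; _⊔_)
open import Data.Nat as ℕ using (ℕ; zero; _^_; _<_; NonZero)
import Data.Nat.Properties as ℕP
open import Data.Nat.DivMod using (_%_)
open import Data.Fin using (Fin; toℕ)
import Data.Fin as Fin
open import Data.Product using (Σ; ∃; ∃-syntax; _×_; _,_)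
open import Data.Sum using (_⊎_)
open import Relation.Binary.PropositionalEquality using (_≡_)
open import Relation.Nullary using (¬_)
open import Relation.Binary.Structures using (IsTotalOrder)
open import Algebra.Bundles using (CommutativeRing)

-- The multiplicative circulant graph MC(m^h)
-- vertex set ℤ_{m^h} represented as Fin (m ^ h); residues as ℕ in [0, m^h).

MCAdj : (m h : ℕ) .{{_ : NonZero (m ^ h)}} → Fin (m ^ h) → Fin (m ^ h) → Set
MCAdj m h x y =
  ¬ (x ≡ y) ×
  ∃[ i ] (i < h × ((toℕ y ℕ.+ m ^ i) % (m ^ h) ≡ toℕ x
                   ⊎ (toℕ x ℕ.+ m ^ i) % (m ^ h) ≡ toℕ y))

data MCWalk (m h : ℕ) .{{_ : NonZero (m ^ h)}} :
            ℕ → Fin (m ^ h) → Fin (m ^ h) → Set where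
  here : ∀ {x} → MCWalk m h zero x x
  step : ∀ {k x y z} → MCAdj m h x y → MCWalk m h k y z →
         MCWalk m h (ℕ.suc k) x z

IsMCDistance : (m h : ℕ) .{{_ : NonZero (m ^ h)}} →
               (Fin (m ^ h) → Fin (m ^ h) → ℕ) → Set
IsMCDistance m h d =
  ∀ x y → MCWalk m h (d x y) x y × (∀ k → k < d x y → ¬ MCWalk m h k x y)

-- Ordered fields (the standard library has none).  The real numbers are
-- one; eigenvalue statements are made over an arbitrary ordered field.

record OrderedField (c ℓ₁ ℓ₂ : Level) : Set (suc (c ⊔ ℓ₁ ⊔ ℓ₂)) where
  field
    commutativeRing : CommutativeRing c ℓ₁
  open CommutativeRing commutativeRing public
  field
    _≤_          : Carrier → Carrier → Set ℓ₂
    isTotalOrder : IsTotalOrder _≈_ _≤_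
    1≉0          : ¬ (1# ≈ 0#)
    inverse      : ∀ x → ¬ (x ≈ 0#) → ∃[ y ] (x * y ≈ 1#)
    +-mono-≤     : ∀ {x y} z → x ≤ y → (x + z) ≤ (y + z)
    *-nonneg     : ∀ {x y} → 0# ≤ x → 0# ≤ y → 0# ≤ (x * y)

module _ {c ℓ₁ ℓ₂} (F : OrderedField c ℓ₁ ℓ₂) where
  open OrderedField F

  fromℕ : ℕ → Carrier
  fromℕ zero      = 0#
  fromℕ (ℕ.suc n) = 1# + fromℕ n

  pow : Carrier → ℕ → Carrier
  pow x zero      = 1#
  pow x (ℕ.suc n) = x * pow x n

  ∑ : ∀ {n} → (Fin n → Carrier) → Carrier
  ∑ {zero}  f = 0#
  ∑ {ℕ.suc n} f = f Fin.zero + ∑ (λ i → f (Fin.suc i))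

  IsEigenvalue : ∀ {n} → (Fin n → Fin n → Carrier) → Carrier → Set (c ⊔ ℓ₁)
  IsEigenvalue {n} A μ =
    Σ (Fin n → Carrier) λ v → ((Σ (Fin n) λ i → ¬ (v i ≈ 0#)) ×
            (∀ i → ∑ (λ j → A i j * v j) ≈ μ * v i))

  -- λ is the largest eigenvalue (= spectral radius, for distance matrices)
  IsLargestEigenvalue : ∀ {n} → (Fin n → Fin n → Carrier) → Carrier →
                        Set (c ⊔ ℓ₁ ⊔ ℓ₂)
  IsLargestEigenvalue A λ′ =
    IsEigenvalue A λ′ × (∀ μ → IsEigenvalue A μ → μ ≤ λ′)

2^h-nonZero : ∀ h → NonZero (2 ^ h)
2^h-nonZero h = ℕ.>-nonZero (ℕP.m^n>0 2 h)

-- The distance from x to y in MC(2^h) depends only on y - x mod 2^h: it is the least number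
-- of terms ±2^i (i < h) summing to y - x, which obeys a recursion on the last binary digit.
-- So every row of the distance matrix has the same sum S_h, and for a nonnegative matrix with
-- constant row sums that sum is the largest eigenvalue.  Splitting S_{h+2} over even and odd
-- residues gives S_{h+2} = S_{h+1} + 2^{h+1} + 2 S_h with S_0 = 0 and S_1 = 1, whose solution
-- is 9 S_h = 2^h (3h + 1) - (-1)^h.
module Submission where

open import Defs
open import Level using (Level)
open import Data.Nat using (ℕ; zero; suc)
open import Data.Fin as Fin using (Fin)
open import Data.Product using (∃-syntax; _,_)
open import Data.Sum using (inj₁; inj₂)
open import Function using (_∘_)
open import Relation.Binary.Core using (Rel)
open import Relation.Binary.Definitions using (Reflexive; Transitive; Total)

maximalIndex : ∀ {a r} {A : Set a} {_≼_ : Rel A r} → Reflexive _≼_ → Transitive _≼_ → Total _≼_ →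
               ∀ {n} (v : Fin (suc n) → A) → ∃[ p ] (∀ k → v k ≼ v p)
maximalIndex refl trans total {zero}  v = Fin.zero , λ { Fin.zero → refl }
maximalIndex refl trans total {suc n} v with maximalIndex refl trans total (v ∘ Fin.suc)
... | p , v≼vp with total (v Fin.zero) (v (Fin.suc p))
...   | inj₁ v0≼vp = Fin.suc p , λ { Fin.zero → v0≼vp ; (Fin.suc k) → v≼vp k }
...   | inj₂ vp≼v0 = Fin.zero , λ { Fin.zero → refl ; (Fin.suc k) → trans (v≼vp k) vp≼v0 }

module Weight where

  open import Data.Nat
  open import Data.Nat.Properties
  open import Data.Nat.Divisibility using (_∣_; divides; *-pres-∣; ∣-refl; 1∣_)
  open import Data.Product using (∃-syntax; _×_; _,_; proj₁)
  open import Data.Sum using (_⊎_; inj₁; inj₂)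
  open import Data.Empty using (⊥-elim)
  open import Function using (_∘_)
  open import Relation.Binary.PropositionalEquality
  open import Data.Nat.Tactic.RingSolver using (solve-∀)
  open import Algebra.Properties.CommutativeSemigroup +-commutativeSemigroup
    using (x∙yz≈y∙xz) renaming (interchange to +-interchange)

  data EvenOdd : ℕ → Set where
    even : ∀ m → EvenOdd (2 * m)
    odd  : ∀ m → EvenOdd (suc (2 * m))

  evenOdd : ∀ n → EvenOdd n
  evenOdd zero = even 0
  evenOdd (suc n) with evenOdd n
  ... | even m = odd m
  ... | odd m  = subst EvenOdd (*-suc 2 m) (even (suc m))

  -- weight h n is the least number of terms ±2^i (i < h) summing to n modulo 2^h, i.e. the
  -- distance from 0 to n in MC(2^h): an even 2m is twice a representation of m, while an odd
  -- 2m+1 uses one term ±1 and leaves 2m or 2m+2.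
  refine : (ℕ → ℕ) → ℕ → ℕ
  refine w zero          = w 0
  refine w (suc zero)    = suc (w 0 ⊓ w 1)
  refine w (suc (suc n)) = refine (w ∘ suc) n

  weight : ℕ → ℕ → ℕ
  weight zero    _ = 0
  weight (suc h)   = refine (weight h)

  refine-even : ∀ w m → refine w (2 * m) ≡ w m
  refine-even w zero    = refl
  refine-even w (suc m) = trans (cong (refine w) (*-suc 2 m)) (refine-even (w ∘ suc) m)

  refine-odd : ∀ w m → refine w (suc (2 * m)) ≡ suc (w m ⊓ w (suc m))
  refine-odd w zero    = refl
  refine-odd w (suc m) = trans (cong (refine w ∘ suc) (*-suc 2 m)) (refine-odd (w ∘ suc) m)

  weight-even : ∀ h m → weight (suc h) (2 * m) ≡ weight h m
  weight-even h = refine-even (weight h)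

  weight-odd : ∀ h m → weight (suc h) (suc (2 * m)) ≡ suc (weight h m ⊓ weight h (suc m))
  weight-odd h = refine-odd (weight h)

  weight-2+even : ∀ h m → weight (suc h) (2 + 2 * m) ≡ weight h (suc m)
  weight-2+even h m = trans (cong (weight (suc h)) (sym (*-suc 2 m))) (weight-even h (suc m))

  weight-0 : ∀ h → weight h 0 ≡ 0
  weight-0 zero    = refl
  weight-0 (suc h) = weight-0 h

  Periodic : ℕ → (ℕ → ℕ) → Set
  Periodic N f = ∀ n → f (n + N) ≡ f n

  Periodic-+-multiple : ∀ {N f} → Periodic N f → ∀ n q → f (n + q * N) ≡ f n
  Periodic-+-multiple {N} {f} per n zero    = cong f (+-identityʳ n)
  Periodic-+-multiple {N} {f} per n (suc q) = begin
    f (n + (N + q * N)) ≡⟨ cong f (trans (cong (n +_) (+-comm N (q * N))) (sym (+-assoc n (q * N) N))) ⟩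
    f (n + q * N + N)   ≡⟨ per (n + q * N) ⟩
    f (n + q * N)       ≡⟨ Periodic-+-multiple per n q ⟩
    f n                 ∎
    where open ≡-Reasoning

  2*m+2*n≡2*[m+n] : ∀ m n → 2 * m + 2 * n ≡ 2 * (m + n)
  2*m+2*n≡2*[m+n] m n = sym (*-distribˡ-+ 2 m n)

  weight-periodic : ∀ h → Periodic (2 ^ h) (weight h)
  weight-periodic zero    n = refl
  weight-periodic (suc h) n with evenOdd n
  ... | even m rewrite 2*m+2*n≡2*[m+n] m (2 ^ h) | weight-even h (m + 2 ^ h) | weight-even h m
    = weight-periodic h m
  ... | odd m rewrite 2*m+2*n≡2*[m+n] m (2 ^ h) | weight-odd h (m + 2 ^ h) | weight-odd h m
                    | weight-periodic h m | weight-periodic h (suc m) = refl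

  m≤1+n⇒m≤1+[m⊓n] : ∀ {m n} → m ≤ suc n → m ≤ suc (m ⊓ n)
  m≤1+n⇒m≤1+[m⊓n] {m} m≤1+n = ⊓-glb (n≤1+n m) m≤1+n

  n≤1+m⇒n≤1+[m⊓n] : ∀ {m n} → n ≤ suc m → n ≤ suc (m ⊓ n)
  n≤1+m⇒n≤1+[m⊓n] {n = n} n≤1+m = ⊓-glb n≤1+m (n≤1+n n)

  n+1≡1+n : ∀ n → n + 1 ≡ suc n
  n+1≡1+n n = +-comm n 1

  weight-≤-suc-weight-+ : ∀ h i n → weight h n ≤ suc (weight h (n + 2 ^ i))
  weight-+-≤-suc-weight : ∀ h i n → weight h (n + 2 ^ i) ≤ suc (weight h n)

  weight-≤-suc-weight-suc : ∀ h n → weight h n ≤ suc (weight h (suc n))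
  weight-≤-suc-weight-suc h n = subst (λ t → weight h n ≤ suc (weight h t)) (n+1≡1+n n)
                                      (weight-≤-suc-weight-+ h 0 n)

  weight-suc-≤-suc-weight : ∀ h n → weight h (suc n) ≤ suc (weight h n)
  weight-suc-≤-suc-weight h n = subst (λ t → weight h t ≤ suc (weight h n)) (n+1≡1+n n)
                                      (weight-+-≤-suc-weight h 0 n)

  weight-≤-suc-weight-+ zero i n = z≤n
  weight-≤-suc-weight-+ (suc h) zero n rewrite n+1≡1+n n with evenOdd n
  ... | even m rewrite weight-odd h m | weight-even h m =
    m≤n⇒m≤1+n (m≤1+n⇒m≤1+[m⊓n] (weight-≤-suc-weight-suc h m))
  ... | odd m rewrite weight-odd h m | weight-2+even h m = s≤s (m⊓n≤n _ _)
  weight-≤-suc-weight-+ (suc h) (suc i) n with evenOdd n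
  ... | even m rewrite 2*m+2*n≡2*[m+n] m (2 ^ i) | weight-even h (m + 2 ^ i) | weight-even h m =
    weight-≤-suc-weight-+ h i m
  ... | odd m rewrite 2*m+2*n≡2*[m+n] m (2 ^ i) | weight-odd h (m + 2 ^ i) | weight-odd h m =
    s≤s (⊓-mono-≤ (weight-≤-suc-weight-+ h i m) (weight-≤-suc-weight-+ h i (suc m)))

  weight-+-≤-suc-weight zero i n = z≤n
  weight-+-≤-suc-weight (suc h) zero n rewrite n+1≡1+n n with evenOdd n
  ... | even m rewrite weight-odd h m | weight-even h m = s≤s (m⊓n≤m _ _)
  ... | odd m rewrite weight-odd h m | weight-2+even h m =
    m≤n⇒m≤1+n (n≤1+m⇒n≤1+[m⊓n] (weight-suc-≤-suc-weight h m))
  weight-+-≤-suc-weight (suc h) (suc i) n with evenOdd n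
  ... | even m rewrite 2*m+2*n≡2*[m+n] m (2 ^ i) | weight-even h (m + 2 ^ i) | weight-even h m =
    weight-+-≤-suc-weight h i m
  ... | odd m rewrite 2*m+2*n≡2*[m+n] m (2 ^ i) | weight-odd h (m + 2 ^ i) | weight-odd h m =
    s≤s (⊓-mono-≤ (weight-+-≤-suc-weight h i m) (weight-+-≤-suc-weight h i (suc m)))

  weight-descent : ∀ h n k → weight h n ≡ suc k →
    ∃[ i ] (i < h × (weight h (n + 2 ^ i) ≡ k ⊎ ∃[ m ] (m + 2 ^ i ≡ n × weight h m ≡ k)))
  weight-descent zero n k ()
  weight-descent (suc h) n k eq with evenOdd n
  ... | even m with weight-descent h m k (trans (sym (weight-even h m)) eq)
  ...   | i , i<h , inj₁ e = suc i , s≤s i<h ,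
    inj₁ (trans (cong (weight (suc h)) (2*m+2*n≡2*[m+n] m (2 ^ i))) (trans (weight-even h (m + 2 ^ i)) e))
  ...   | i , i<h , inj₂ (z , z+2^i≡m , e) = suc i , s≤s i<h ,
    inj₂ (2 * z , trans (2*m+2*n≡2*[m+n] z (2 ^ i)) (cong (2 *_) z+2^i≡m) , trans (weight-even h z) e)
  weight-descent (suc h) n k eq | odd m with ⊓-sel (weight h m) (weight h (suc m))
  ... | inj₁ min≡left = 0 , s≤s z≤n ,
    inj₂ (2 * m , n+1≡1+n (2 * m) , trans (weight-even h m) (trans (sym min≡left) min≡k))
    where min≡k = suc-injective (trans (sym (weight-odd h m)) eq)
  ... | inj₂ min≡right = 0 , s≤s z≤n ,
    inj₁ (trans (cong (weight (suc h)) (n+1≡1+n (suc (2 * m))))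
                (trans (weight-2+even h m) (trans (sym min≡right) min≡k)))
    where min≡k = suc-injective (trans (sym (weight-odd h m)) eq)

  weight≡0⇒2^h∣n : ∀ h n → weight h n ≡ 0 → 2 ^ h ∣ n
  weight≡0⇒2^h∣n zero    n _ = 1∣ n
  weight≡0⇒2^h∣n (suc h) n eq with evenOdd n
  ... | odd m  = ⊥-elim (0≢1+n (sym (trans (sym (weight-odd h m)) eq)))
  ... | even m = *-pres-∣ (∣-refl {2}) (weight≡0⇒2^h∣n h m (trans (sym (weight-even h m)) eq))

  sumBelow : ℕ → (ℕ → ℕ) → ℕ
  sumBelow zero    f = 0
  sumBelow (suc n) f = f 0 + sumBelow n (f ∘ suc)

  sumBelow-cong : ∀ n {f g} → (∀ j → f j ≡ g j) → sumBelow n f ≡ sumBelow n g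
  sumBelow-cong zero    f≗g = refl
  sumBelow-cong (suc n) f≗g = cong₂ _+_ (f≗g 0) (sumBelow-cong n (f≗g ∘ suc))

  sumBelow-suc : ∀ n f → sumBelow (suc n) f ≡ sumBelow n f + f n
  sumBelow-suc zero    f = +-comm (f 0) 0
  sumBelow-suc (suc n) f = trans (cong (f 0 +_) (sumBelow-suc n (f ∘ suc))) (sym (+-assoc (f 0) _ _))

  sumBelow-rotate : ∀ N f → f N ≡ f 0 → sumBelow N (f ∘ suc) ≡ sumBelow N f
  sumBelow-rotate N f fN≡f0 = +-cancelˡ-≡ (f 0) _ _ (begin
    f 0 + sumBelow N (f ∘ suc) ≡⟨ sumBelow-suc N f ⟩
    sumBelow N f + f N         ≡⟨ cong (sumBelow N f +_) fN≡f0 ⟩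
    sumBelow N f + f 0         ≡⟨ +-comm (sumBelow N f) (f 0) ⟩
    f 0 + sumBelow N f         ∎)
    where open ≡-Reasoning

  sumBelow-shift : ∀ N f → Periodic N f → ∀ c → sumBelow N (λ j → f (j + c)) ≡ sumBelow N f
  sumBelow-shift N f per zero    = sumBelow-cong N (λ j → cong f (+-identityʳ j))
  sumBelow-shift N f per (suc c) = begin
    sumBelow N (λ j → f (j + suc c)) ≡⟨ sumBelow-cong N (λ j → cong f (+-suc j c)) ⟩
    sumBelow N (λ j → f (suc j + c))
      ≡⟨ sumBelow-rotate N (λ j → f (j + c)) (trans (cong f (+-comm N c)) (per c)) ⟩
    sumBelow N (λ j → f (j + c))     ≡⟨ sumBelow-shift N f per c ⟩
    sumBelow N f                     ∎
    where open ≡-Reasoning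

  sumBelow-evenOdd : ∀ n f →
    sumBelow (2 * n) f ≡ sumBelow n (λ m → f (2 * m)) + sumBelow n (λ m → f (suc (2 * m)))
  sumBelow-evenOdd zero    f = refl
  sumBelow-evenOdd (suc n) f = begin
    sumBelow (2 * suc n) f
      ≡⟨ cong (λ t → sumBelow t f) (*-suc 2 n) ⟩
    f 0 + (f 1 + sumBelow (2 * n) (f ∘ suc ∘ suc))
      ≡⟨ cong (λ t → f 0 + (f 1 + t)) (sumBelow-evenOdd n (f ∘ suc ∘ suc)) ⟩
    f 0 + (f 1 + (sumBelow n (λ m → f (2 + 2 * m)) + sumBelow n (λ m → f (3 + 2 * m))))
      ≡⟨ sym (+-assoc (f 0) (f 1) _) ⟩
    (f 0 + f 1) + (sumBelow n (λ m → f (2 + 2 * m)) + sumBelow n (λ m → f (3 + 2 * m)))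
      ≡⟨ +-interchange (f 0) (f 1) _ _ ⟩
    (f 0 + sumBelow n (λ m → f (2 + 2 * m))) + (f 1 + sumBelow n (λ m → f (3 + 2 * m)))
      ≡⟨ cong₂ (λ a b → (f 0 + a) + (f 1 + b))
               (sumBelow-cong n (λ m → cong f (sym (*-suc 2 m))))
               (sumBelow-cong n (λ m → cong (f ∘ suc) (sym (*-suc 2 m)))) ⟩
    sumBelow (suc n) (λ m → f (2 * m)) + sumBelow (suc n) (λ m → f (suc (2 * m))) ∎
    where open ≡-Reasoning

  sumBelow-suc-pointwise : ∀ n f → sumBelow n (suc ∘ f) ≡ n + sumBelow n f
  sumBelow-suc-pointwise zero    f = refl
  sumBelow-suc-pointwise (suc n) f = cong suc (begin
    f 0 + sumBelow n (suc ∘ f ∘ suc) ≡⟨ cong (f 0 +_) (sumBelow-suc-pointwise n (f ∘ suc)) ⟩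
    f 0 + (n + sumBelow n (f ∘ suc)) ≡⟨ x∙yz≈y∙xz (f 0) n _ ⟩
    n + (f 0 + sumBelow n (f ∘ suc)) ∎)
    where open ≡-Reasoning

  evenIndicator : ℕ → ℕ
  evenIndicator zero          = 1
  evenIndicator (suc zero)    = 0
  evenIndicator (suc (suc h)) = evenIndicator h

  -- (-1)^h appears as evenIndicator h - evenIndicator (1 + h), keeping everything in ℕ.
  recurrence-closedForm : (s : ℕ → ℕ) → s 0 ≡ 0 → s 1 ≡ 1 →
    (∀ h → s (2 + h) ≡ s (1 + h) + (2 ^ (1 + h) + (s h + s h))) →
    ∀ h → 9 * s h + evenIndicator h ≡ 2 ^ h * (3 * h + 1) + evenIndicator (1 + h)
  recurrence-closedForm s s0≡0 s1≡1 rec h = proj₁ (twoSteps h)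
    where
    P : ℕ → Set
    P h = 9 * s h + evenIndicator h ≡ 2 ^ h * (3 * h + 1) + evenIndicator (1 + h)

    expand : ∀ s₀ s₁ p e o →
      (9 * (s₁ + (2 * p + (s₀ + s₀))) + e) + (2 * e + o) ≡ ((9 * s₁ + o) + 18 * p) + (2 * (9 * s₀ + e) + e)
    expand = solve-∀

    collect : ∀ p h e o →
      ((2 * p * (3 * (1 + h) + 1) + e) + 18 * p) + (2 * (p * (3 * h + 1) + o) + e)
        ≡ (2 * (2 * p) * (3 * (2 + h) + 1) + o) + (2 * e + o)
    collect = solve-∀

    twoSteps : ∀ h → P h × P (1 + h)
    twoSteps zero = cong (λ t → 9 * t + 1) s0≡0 , cong (λ t → 9 * t + 0) s1≡1
    twoSteps (suc h) with twoSteps h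
    ... | Ph , P1+h = P1+h , +-cancelʳ-≡ (2 * e + o) _ _ (begin
      (9 * s (2 + h) + e) + (2 * e + o)
        ≡⟨ cong (λ t → (9 * t + e) + (2 * e + o)) (rec h) ⟩
      (9 * (s (1 + h) + (2 * p + (s h + s h))) + e) + (2 * e + o)
        ≡⟨ expand (s h) (s (1 + h)) p e o ⟩
      ((9 * s (1 + h) + o) + 18 * p) + (2 * (9 * s h + e) + e)
        ≡⟨ cong₂ (λ a b → (a + 18 * p) + (2 * b + e)) P1+h Ph ⟩
      ((2 * p * (3 * (1 + h) + 1) + e) + 18 * p) + (2 * (p * (3 * h + 1) + o) + e)
        ≡⟨ collect p h e o ⟩
      (2 * (2 * p) * (3 * (2 + h) + 1) + o) + (2 * e + o) ∎)
      where
      open ≡-Reasoning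
      p = 2 ^ h
      e = evenIndicator h
      o = evenIndicator (1 + h)

  weightSum : ℕ → ℕ
  weightSum h = sumBelow (2 ^ h) (weight h)

  adjacentMinSum : ℕ → ℕ
  adjacentMinSum h = sumBelow (2 ^ h) (λ m → weight h m ⊓ weight h (suc m))

  weightSum-suc : ∀ h → weightSum (suc h) ≡ weightSum h + (2 ^ h + adjacentMinSum h)
  weightSum-suc h = begin
    sumBelow (2 * 2 ^ h) (weight (suc h))
      ≡⟨ sumBelow-evenOdd (2 ^ h) (weight (suc h)) ⟩
    sumBelow (2 ^ h) (weight (suc h) ∘ (2 *_)) + sumBelow (2 ^ h) (weight (suc h) ∘ suc ∘ (2 *_))
      ≡⟨ cong₂ _+_ (sumBelow-cong (2 ^ h) (weight-even h)) (sumBelow-cong (2 ^ h) (weight-odd h)) ⟩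
    weightSum h + sumBelow (2 ^ h) (λ m → suc (weight h m ⊓ weight h (suc m)))
      ≡⟨ cong (weightSum h +_) (sumBelow-suc-pointwise (2 ^ h) _) ⟩
    weightSum h + (2 ^ h + adjacentMinSum h) ∎
    where open ≡-Reasoning

  adjacentMinSum-suc : ∀ h → adjacentMinSum (suc h) ≡ weightSum h + weightSum h
  adjacentMinSum-suc h = begin
    adjacentMinSum (suc h)
      ≡⟨ sumBelow-evenOdd (2 ^ h) _ ⟩
    sumBelow (2 ^ h) (λ m → W′ (2 * m) ⊓ W′ (suc (2 * m)))
      + sumBelow (2 ^ h) (λ m → W′ (suc (2 * m)) ⊓ W′ (2 + 2 * m))
      ≡⟨ cong₂ _+_ (sumBelow-cong (2 ^ h) evenMin) (sumBelow-cong (2 ^ h) oddMin) ⟩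
    weightSum h + sumBelow (2 ^ h) (λ m → weight h (m + 1))
      ≡⟨ cong (weightSum h +_) (sumBelow-shift (2 ^ h) (weight h) (weight-periodic h) 1) ⟩
    weightSum h + weightSum h ∎
    where
    open ≡-Reasoning
    W′ = weight (suc h)
    evenMin : ∀ m → W′ (2 * m) ⊓ W′ (suc (2 * m)) ≡ weight h m
    evenMin m rewrite weight-even h m | weight-odd h m =
      m≤n⇒m⊓n≡m (m≤1+n⇒m≤1+[m⊓n] (weight-≤-suc-weight-suc h m))
    oddMin : ∀ m → W′ (suc (2 * m)) ⊓ W′ (2 + 2 * m) ≡ weight h (m + 1)
    oddMin m rewrite weight-odd h m | weight-2+even h m | n+1≡1+n m =
      m≥n⇒m⊓n≡n (n≤1+m⇒n≤1+[m⊓n] (weight-suc-≤-suc-weight h m))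

  weightSum-closedForm : ∀ h → 9 * weightSum h + evenIndicator h ≡ 2 ^ h * (3 * h + 1) + evenIndicator (1 + h)
  weightSum-closedForm = recurrence-closedForm weightSum refl refl λ h →
    trans (weightSum-suc (suc h)) (cong (λ t → weightSum (suc h) + (2 ^ suc h + t)) (adjacentMinSum-suc h))

module Distance (h : ℕ) where
  open import Data.Nat
  open import Data.Nat.Properties
  open import Data.Nat.DivMod
  open import Data.Nat.Divisibility using (_∣_; divides; ∣⇒≤)
  open import Data.Fin using (toℕ; fromℕ<)
  open import Data.Fin.Properties using (toℕ-injective; toℕ<n; toℕ-fromℕ<)
  open import Data.Product using (_,_; proj₁; proj₂)
  open import Data.Sum using (inj₁; inj₂)
  open import Relation.Binary.PropositionalEquality
  open import Relation.Nullary using (¬_)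
  open import Algebra.Properties.CommutativeSemigroup +-commutativeSemigroup using (xy∙z≈xz∙y)
  open Weight

  m%n≡k⇒m≡k+[m/n]*n : ∀ {m k} n .{{_ : NonZero n}} → m % n ≡ k → m ≡ k + (m / n) * n
  m%n≡k⇒m≡k+[m/n]*n {m} n m%n≡k = trans (m≡m%n+[m/n]*n m n) (cong (_+ (m / n) * n) m%n≡k)

  [m%n+k]%n≡[m+k]%n : ∀ m k n .{{_ : NonZero n}} → (m % n + k) % n ≡ (m + k) % n
  [m%n+k]%n≡[m+k]%n m k n = begin
    (m % n + k) % n           ≡⟨ %-distribˡ-+ (m % n) k n ⟩
    (m % n % n + k % n) % n   ≡⟨ cong (λ t → (t + k % n) % n) (m%n%n≡m%n m n) ⟩
    (m % n + k % n) % n       ≡⟨ %-distribˡ-+ m k n ⟨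
    (m + k) % n               ∎
    where open ≡-Reasoning

  instance
    2^h≢0 : NonZero (2 ^ h)
    2^h≢0 = 2^h-nonZero h

  N : ℕ
  N = 2 ^ h

  -- A representative of y - x modulo N that avoids truncated subtraction.
  offset : Fin N → Fin N → ℕ
  offset x y = toℕ y + (N ∸ toℕ x)

  δ : Fin N → Fin N → ℕ
  δ x y = weight h (offset x y)

  offset+toℕ : ∀ x y → offset x y + toℕ x ≡ toℕ y + N
  offset+toℕ x y = trans (+-assoc (toℕ y) _ _) (cong (toℕ y +_) (m∸n+n≡m (<⇒≤ (toℕ<n x))))

  offset-step : ∀ x x′ y {p} → (toℕ x′ + p) % N ≡ toℕ x →
                offset x y + p ≡ offset x′ y + ((toℕ x′ + p) / N) * N
  offset-step x x′ y {p} x′+p≡x = +-cancelʳ-≡ (toℕ x′) _ _ (begin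
    offset x y + p + toℕ x′      ≡⟨ +-assoc (offset x y) p (toℕ x′) ⟩
    offset x y + (p + toℕ x′)    ≡⟨ cong (offset x y +_) (trans (+-comm p (toℕ x′)) x′+p≡x+qN) ⟩
    offset x y + (toℕ x + q * N) ≡⟨ +-assoc (offset x y) (toℕ x) (q * N) ⟨
    offset x y + toℕ x + q * N   ≡⟨ cong (_+ q * N) (trans (offset+toℕ x y) (sym (offset+toℕ x′ y))) ⟩
    offset x′ y + toℕ x′ + q * N ≡⟨ xy∙z≈xz∙y (offset x′ y) (toℕ x′) (q * N) ⟩
    offset x′ y + q * N + toℕ x′ ∎)
    where
    open ≡-Reasoning
    q = (toℕ x′ + p) / N
    x′+p≡x+qN = m%n≡k⇒m≡k+[m/n]*n N x′+p≡x

  δ-step : ∀ x x′ y {p} → (toℕ x′ + p) % N ≡ toℕ x → weight h (offset x y + p) ≡ δ x′ y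
  δ-step x x′ y {p} e = trans (cong (weight h) (offset-step x x′ y e))
                              (Periodic-+-multiple (weight-periodic h) (offset x′ y) ((toℕ x′ + p) / N))

  δ-adjacent : ∀ {x x′} y → MCAdj 2 h x x′ → δ x y ≤ suc (δ x′ y)
  δ-adjacent {x} {x′} y (_ , i , _ , inj₁ e) =
    subst (λ t → δ x y ≤ suc t) (δ-step x x′ y e) (weight-≤-suc-weight-+ h i (offset x y))
  δ-adjacent {x} {x′} y (_ , i , _ , inj₂ e) =
    subst (_≤ suc (δ x′ y)) (δ-step x′ x y e) (weight-+-≤-suc-weight h i (offset x′ y))

  δ-refl : ∀ x → δ x x ≡ 0
  δ-refl x = trans (cong (weight h) (m+[n∸m]≡n (<⇒≤ (toℕ<n x))))
                   (trans (weight-periodic h 0) (weight-0 h))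

  δ≤walkLength : ∀ {k x y} → MCWalk 2 h k x y → δ x y ≤ k
  δ≤walkLength {x = x} here = ≤-reflexive (δ-refl x)
  δ≤walkLength {y = y} (step adj w) = ≤-trans (δ-adjacent y adj) (s≤s (δ≤walkLength w))

  N∣offset⇒≡ : ∀ x y → N ∣ offset x y → x ≡ y
  N∣offset⇒≡ x y (divides q offset≡qN) = toℕ-injective (begin
    toℕ x                      ≡⟨ m<n⇒m%n≡m (toℕ<n x) ⟨
    toℕ x % N                  ≡⟨ [m+kn]%n≡m%n (toℕ x) q N ⟨
    (toℕ x + q * N) % N        ≡⟨ cong (_% N) (trans (+-comm (toℕ x) (q * N)) (cong (_+ toℕ x) (sym offset≡qN))) ⟩
    (offset x y + toℕ x) % N   ≡⟨ cong (_% N) (offset+toℕ x y) ⟩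
    (toℕ y + N) % N            ≡⟨ [m+n]%n≡m%n (toℕ y) N ⟩
    toℕ y % N                  ≡⟨ m<n⇒m%n≡m (toℕ<n y) ⟩
    toℕ y                      ∎)
    where open ≡-Reasoning

  2^i<N : ∀ {i} → i < h → 2 ^ i < N
  2^i<N = ^-monoʳ-< 2 (s≤s (s≤s z≤n))

  +2^i-moves : ∀ {i} (x : Fin N) → i < h → ¬ ((toℕ x + 2 ^ i) % N ≡ toℕ x)
  +2^i-moves {i} x i<h e = <⇒≱ (2^i<N i<h) (∣⇒≤ {{>-nonZero (m^n>0 2 i)}} N∣2^i)
    where
    N∣2^i : N ∣ 2 ^ i
    N∣2^i = divides ((toℕ x + 2 ^ i) / N) (+-cancelˡ-≡ (toℕ x) _ _ (m%n≡k⇒m≡k+[m/n]*n N e))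

  adjacent-up : ∀ {x x′ i} → i < h → (toℕ x + 2 ^ i) % N ≡ toℕ x′ → MCAdj 2 h x x′
  adjacent-up {x} i<h e = (λ { refl → +2^i-moves x i<h e }) , _ , i<h , inj₂ e

  adjacent-down : ∀ {x x′ i} → i < h → (toℕ x′ + 2 ^ i) % N ≡ toℕ x → MCAdj 2 h x x′
  adjacent-down {x} i<h e = (λ { refl → +2^i-moves x i<h e }) , _ , i<h , inj₁ e

  up : ℕ → Fin N → Fin N
  up i x = fromℕ< (m%n<n (toℕ x + 2 ^ i) N)

  up-spec : ∀ i x → (toℕ x + 2 ^ i) % N ≡ toℕ (up i x)
  up-spec i x = sym (toℕ-fromℕ< (m%n<n (toℕ x + 2 ^ i) N))

  down : ℕ → Fin N → Fin N
  down i x = fromℕ< (m%n<n (toℕ x + (N ∸ 2 ^ i)) N)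

  down-spec : ∀ {i} x → i < h → (toℕ (down i x) + 2 ^ i) % N ≡ toℕ x
  down-spec {i} x i<h = begin
    (toℕ (down i x) + 2 ^ i) % N   ≡⟨ cong (λ t → (t + 2 ^ i) % N) (toℕ-fromℕ< (m%n<n _ N)) ⟩
    ((toℕ x + (N ∸ 2 ^ i)) % N + 2 ^ i) % N ≡⟨ [m%n+k]%n≡[m+k]%n (toℕ x + (N ∸ 2 ^ i)) (2 ^ i) N ⟩
    (toℕ x + (N ∸ 2 ^ i) + 2 ^ i) % N
      ≡⟨ cong (_% N) (trans (+-assoc (toℕ x) _ _) (cong (toℕ x +_) (m∸n+n≡m (<⇒≤ (2^i<N i<h))))) ⟩
    (toℕ x + N) % N                 ≡⟨ [m+n]%n≡m%n (toℕ x) N ⟩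
    toℕ x % N                       ≡⟨ m<n⇒m%n≡m (toℕ<n x) ⟩
    toℕ x                           ∎
    where open ≡-Reasoning

  walkOfLength-δ : ∀ k x y → δ x y ≡ k → MCWalk 2 h k x y
  walkOfLength-δ zero x y δ≡0 rewrite N∣offset⇒≡ x y (weight≡0⇒2^h∣n h (offset x y) δ≡0) = here
  walkOfLength-δ (suc k) x y δ≡1+k with weight-descent h (offset x y) k δ≡1+k
  ... | i , i<h , inj₁ e =
    step (adjacent-down i<h (down-spec x i<h))
         (walkOfLength-δ k _ y (trans (sym (δ-step x (down i x) y (down-spec x i<h))) e))
  ... | i , i<h , inj₂ (m , m+2^i≡offset , e) =
    step (adjacent-up i<h (up-spec i x)) (walkOfLength-δ k _ y (begin
      δ (up i x) y              ≡⟨ cong (weight h) (+-cancelʳ-≡ (2 ^ i) _ _ offset′+2^i≡m+2^i+qN) ⟩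
      weight h (m + q * N)      ≡⟨ Periodic-+-multiple (weight-periodic h) m q ⟩
      weight h m                ≡⟨ e ⟩
      k                         ∎))
    where
    open ≡-Reasoning
    q = (toℕ x + 2 ^ i) / N
    offset′+2^i≡m+2^i+qN : offset (up i x) y + 2 ^ i ≡ m + q * N + 2 ^ i
    offset′+2^i≡m+2^i+qN = begin
      offset (up i x) y + 2 ^ i ≡⟨ offset-step (up i x) x y (up-spec i x) ⟩
      offset x y + q * N        ≡⟨ cong (_+ q * N) (sym m+2^i≡offset) ⟩
      m + 2 ^ i + q * N         ≡⟨ xy∙z≈xz∙y m (2 ^ i) (q * N) ⟩
      m + q * N + 2 ^ i         ∎

  δ-isDistance : (d : Fin N → Fin N → ℕ) → IsMCDistance 2 h d → ∀ x y → d x y ≡ δ x y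
  δ-isDistance d isDist x y =
    ≤-antisym (≮⇒≥ (λ δ<d → proj₂ (isDist x y) (δ x y) δ<d (walkOfLength-δ (δ x y) x y refl)))
              (δ≤walkLength (proj₁ (isDist x y)))

module OrderedFieldProperties {c ℓ₁ ℓ₂} (F : OrderedField c ℓ₁ ℓ₂) where
  open import Data.Nat as ℕ using (ℕ; zero; suc)
  open import Data.Fin using (toℕ)
  open import Data.Product using (proj₁; proj₂)
  open import Function using (flip)
  import Relation.Binary.PropositionalEquality as ≡
  open import Relation.Binary.Structures using (IsTotalOrder)
  open import Relation.Nullary using (¬_)
  open Weight using (sumBelow; evenIndicator)

  open OrderedField F
  open IsTotalOrder isTotalOrder
    using (total; antisym; ≲-respˡ-≈; ≲-respʳ-≈)
    renaming (refl to ≤-refl; trans to ≤-trans; reflexive to ≤-reflexive)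
  open import Algebra.Properties.Ring ring
  open import Algebra.Properties.Semiring.Mult semiring using (_×_; ×-homo-+; ×1-homo-*)
  open import Relation.Binary.Reasoning.Setoid setoid

  x≤y⇒0≤y-x : ∀ {x y} → x ≤ y → 0# ≤ (y - x)
  x≤y⇒0≤y-x {x} x≤y = ≲-respˡ-≈ (-‿inverseʳ x) (+-mono-≤ (- x) x≤y)

  x≤y⇒x-y≤0 : ∀ {x y} → x ≤ y → (x - y) ≤ 0#
  x≤y⇒x-y≤0 {y = y} x≤y = ≲-respʳ-≈ (-‿inverseʳ y) (+-mono-≤ (- y) x≤y)

  0≤y-x⇒x≤y : ∀ {x y} → 0# ≤ (y - x) → x ≤ y
  0≤y-x⇒x≤y {x} {y} 0≤y-x = ≲-respʳ-≈ y-x+x≈y (≲-respˡ-≈ (+-identityˡ x) (+-mono-≤ x 0≤y-x))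
    where
    y-x+x≈y : (y - x) + x ≈ y
    y-x+x≈y = begin
      (y - x) + x   ≈⟨ +-assoc y (- x) x ⟩
      y + (- x + x) ≈⟨ +-congˡ (-‿inverseˡ x) ⟩
      y + 0#        ≈⟨ +-identityʳ y ⟩
      y             ∎

  +-mono₂-≤ : ∀ {a b c d} → a ≤ b → c ≤ d → (a + c) ≤ (b + d)
  +-mono₂-≤ {a} {b} {c} {d} a≤b c≤d = ≤-trans (+-mono-≤ c a≤b)
    (≲-respˡ-≈ (+-comm c b) (≲-respʳ-≈ (+-comm d b) (+-mono-≤ b c≤d)))

  *-monoˡ-≤-nonNeg : ∀ {c a b} → 0# ≤ c → a ≤ b → (c * a) ≤ (c * b)
  *-monoˡ-≤-nonNeg {c} {a} {b} 0≤c a≤b =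
    0≤y-x⇒x≤y (≲-respʳ-≈ (x[y-z]≈xy-xz c b a) (*-nonneg 0≤c (x≤y⇒0≤y-x a≤b)))

  -- If 1 < 0 then 0 < -1, and -1 * -1 = 1 would be nonnegative.
  0≤1 : 0# ≤ 1#
  0≤1 with total 0# 1#
  ... | inj₁ 0≤1 = 0≤1
  ... | inj₂ 1≤0 = ≲-respʳ-≈ -1*-1≈1 (*-nonneg 0≤-1 0≤-1)
    where
    0≤-1 : 0# ≤ (- 1#)
    0≤-1 = ≲-respˡ-≈ (-‿inverseʳ 1#) (≲-respʳ-≈ (+-identityˡ (- 1#)) (+-mono-≤ (- 1#) 1≤0))
    -1*-1≈1 : - 1# * - 1# ≈ 1#
    -1*-1≈1 = trans (-1*x≈-x (- 1#)) (-‿involutive 1#)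

  x*y≈0⇒x≈0 : ∀ {x y} → ¬ y ≈ 0# → x * y ≈ 0# → x ≈ 0#
  x*y≈0⇒x≈0 {x} {y} y≉0 xy≈0 with inverse y y≉0
  ... | y⁻¹ , y*y⁻¹≈1 = begin
    x             ≈⟨ *-identityʳ x ⟨
    x * 1#        ≈⟨ *-congˡ y*y⁻¹≈1 ⟨
    x * (y * y⁻¹) ≈⟨ *-assoc x y y⁻¹ ⟨
    (x * y) * y⁻¹ ≈⟨ *-congʳ xy≈0 ⟩
    0# * y⁻¹      ≈⟨ zeroˡ y⁻¹ ⟩
    0#            ∎

  x-y≈0⇒x≈y : ∀ {x y} → x - y ≈ 0# → x ≈ y
  x-y≈0⇒x≈y {x} {y} x-y≈0 = begin
    x              ≈⟨ +-identityʳ x ⟨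
    x + 0#         ≈⟨ +-congˡ (-‿inverseˡ y) ⟨
    x + (- y + y)  ≈⟨ +-assoc x (- y) y ⟨
    (x - y) + y    ≈⟨ +-congʳ x-y≈0 ⟩
    0# + y         ≈⟨ +-identityˡ y ⟩
    y              ∎

  x+y≈z+w⇒x≈z-[y-w] : ∀ {x y z w} → x + y ≈ z + w → x ≈ z - (y - w)
  x+y≈z+w⇒x≈z-[y-w] {x} {y} {z} {w} x+y≈z+w = begin
    x                  ≈⟨ +-identityʳ x ⟨
    x + 0#             ≈⟨ +-congˡ (-‿inverseʳ y) ⟨
    x + (y - y)        ≈⟨ +-assoc x y (- y) ⟨
    (x + y) - y        ≈⟨ +-congʳ x+y≈z+w ⟩
    (z + w) - y        ≈⟨ +-assoc z w (- y) ⟩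
    z + (w - y)        ≈⟨ +-congˡ (⁻¹-anti-homo‿- y w) ⟨
    z - (y - w)        ∎

  ∑-cong : ∀ {n} {f g : Fin n → Carrier} → (∀ i → f i ≈ g i) → ∑ F f ≈ ∑ F g
  ∑-cong {zero}  f≈g = refl
  ∑-cong {suc n} f≈g = +-cong (f≈g Fin.zero) (∑-cong (f≈g ∘ Fin.suc))

  ∑-mono-≤ : ∀ {n} {f g : Fin n → Carrier} → (∀ i → f i ≤ g i) → ∑ F f ≤ ∑ F g
  ∑-mono-≤ {zero}  f≤g = ≤-refl
  ∑-mono-≤ {suc n} f≤g = +-mono₂-≤ (f≤g Fin.zero) (∑-mono-≤ (f≤g ∘ Fin.suc))

  ∑-*ʳ : ∀ {n} (f : Fin n → Carrier) c → ∑ F (λ i → f i * c) ≈ ∑ F f * c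
  ∑-*ʳ {zero}  f c = sym (zeroˡ c)
  ∑-*ʳ {suc n} f c = trans (+-congˡ (∑-*ʳ (f ∘ Fin.suc) c)) (sym (distribʳ c _ _))

  ∑-weighted-≤ : ∀ {n} {a v : Fin n → Carrier} {t} → (∀ j → 0# ≤ a j) → (∀ j → v j ≤ t) →
                 ∑ F (λ j → a j * v j) ≤ (∑ F a * t)
  ∑-weighted-≤ {a = a} {t = t} 0≤a v≤t =
    ≲-respʳ-≈ (∑-*ʳ a t) (∑-mono-≤ (λ j → *-monoˡ-≤-nonNeg (0≤a j) (v≤t j)))

  ∑-weighted-≥ : ∀ {n} {a v : Fin n → Carrier} {t} → (∀ j → 0# ≤ a j) → (∀ j → t ≤ v j) →
                 (∑ F a * t) ≤ ∑ F (λ j → a j * v j)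
  ∑-weighted-≥ {a = a} {t = t} 0≤a t≤v =
    ≲-respˡ-≈ (∑-*ʳ a t) (∑-mono-≤ (λ j → *-monoˡ-≤-nonNeg (0≤a j) (t≤v j)))

  fromℕ≡×1# : ∀ n → fromℕ F n ≡.≡ n × 1#
  fromℕ≡×1# zero    = ≡.refl
  fromℕ≡×1# (suc n) = ≡.cong (1# +_) (fromℕ≡×1# n)

  fromℕ-+ : ∀ m n → fromℕ F (m ℕ.+ n) ≈ fromℕ F m + fromℕ F n
  fromℕ-+ m n rewrite fromℕ≡×1# m | fromℕ≡×1# n | fromℕ≡×1# (m ℕ.+ n) = ×-homo-+ 1# m n

  fromℕ-* : ∀ m n → fromℕ F (m ℕ.* n) ≈ fromℕ F m * fromℕ F n
  fromℕ-* m n rewrite fromℕ≡×1# m | fromℕ≡×1# n | fromℕ≡×1# (m ℕ.* n) = ×1-homo-* m n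

  0≤fromℕ : ∀ n → 0# ≤ fromℕ F n
  0≤fromℕ zero    = ≤-refl
  0≤fromℕ (suc n) = ≲-respˡ-≈ (+-identityˡ 0#) (+-mono₂-≤ 0≤1 (0≤fromℕ n))

  ∑-fromℕ : ∀ n (f : ℕ → ℕ) → ∑ F {n} (λ j → fromℕ F (f (toℕ j))) ≈ fromℕ F (sumBelow n f)
  ∑-fromℕ zero    f = refl
  ∑-fromℕ (suc n) f = trans (+-congˡ (∑-fromℕ n (f ∘ suc))) (sym (fromℕ-+ (f 0) _))

  pow-[-1] : ∀ h → pow F (- 1#) h ≈ fromℕ F (evenIndicator h) - fromℕ F (evenIndicator (suc h))
  pow-[-1] zero = sym (begin
    (1# + 0#) - 0# ≈⟨ +-congʳ (+-identityʳ 1#) ⟩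
    1# - 0#        ≈⟨ +-congˡ -0#≈0# ⟩
    1# + 0#        ≈⟨ +-identityʳ 1# ⟩
    1#             ∎)
  pow-[-1] (suc h) = begin
    - 1# * pow F (- 1#) h  ≈⟨ -1*x≈-x _ ⟩
    - pow F (- 1#) h       ≈⟨ -‿cong (pow-[-1] h) ⟩
    - (fromℕ F (evenIndicator h) - fromℕ F (evenIndicator (suc h)))
                           ≈⟨ ⁻¹-anti-homo‿- _ _ ⟩
    fromℕ F (evenIndicator (suc h)) - fromℕ F (evenIndicator h) ∎


  9s+e≡E+o⇒9s≈E-[-1]^h : ∀ {s E} h → 9 ℕ.* s ℕ.+ evenIndicator h ≡.≡ E ℕ.+ evenIndicator (suc h) →
                          fromℕ F 9 * fromℕ F s ≈ fromℕ F E - pow F (- 1#) h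
  9s+e≡E+o⇒9s≈E-[-1]^h {s} {E} h 9s+e≡E+o = begin
    fromℕ F 9 * fromℕ F s
      ≈⟨ x+y≈z+w⇒x≈z-[y-w] (begin
           fromℕ F 9 * fromℕ F s + fromℕ F e ≈⟨ +-congʳ (fromℕ-* 9 s) ⟨
           fromℕ F (9 ℕ.* s) + fromℕ F e     ≈⟨ fromℕ-+ (9 ℕ.* s) e ⟨
           fromℕ F (9 ℕ.* s ℕ.+ e)           ≡⟨ ≡.cong (fromℕ F) 9s+e≡E+o ⟩
           fromℕ F (E ℕ.+ o)                 ≈⟨ fromℕ-+ E o ⟩
           fromℕ F E + fromℕ F o             ∎) ⟩
    fromℕ F E - (fromℕ F e - fromℕ F o) ≈⟨ +-congˡ (-‿cong (pow-[-1] h)) ⟨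
    fromℕ F E - pow F (- 1#) h          ∎
    where
    e = evenIndicator h
    o = evenIndicator (suc h)

  -- Perron–Frobenius for constant row sums: compare an eigenvector at its largest and its smallest entry.
  constantRowSum⇒isLargestEigenvalue :
    ∀ {n} (A : Fin n → Fin n → Carrier) {R} → Fin n → (∀ i j → 0# ≤ A i j) →
    (∀ i → ∑ F (A i) ≈ R) → IsLargestEigenvalue F A R
  constantRowSum⇒isLargestEigenvalue {suc n} A {R} i₀ 0≤A rowSum≈R = onesEigenvector , largest
    where
    onesEigenvector : IsEigenvalue F A R
    onesEigenvector = (λ _ → 1#) , (i₀ , 1≉0) , λ i → begin
      ∑ F (λ j → A i j * 1#) ≈⟨ ∑-cong (λ j → *-identityʳ (A i j)) ⟩
      ∑ F (A i)              ≈⟨ rowSum≈R i ⟩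
      R                      ≈⟨ *-identityʳ R ⟨
      R * 1#                 ∎

    largest : ∀ μ → IsEigenvalue F A μ → μ ≤ R
    largest μ (v , (i , vᵢ≉0) , Av≈μv) with total μ R
    ... | inj₁ μ≤R = μ≤R
    ... | inj₂ R≤μ = ≤-reflexive (x-y≈0⇒x≈y (x*y≈0⇒x≈0 vᵢ≉0 (antisym gapvᵢ≤0 0≤gapvᵢ)))
      where
      gap = μ - R
      gap*v≈μv-Rv : ∀ j → gap * v j ≈ μ * v j - R * v j
      gap*v≈μv-Rv j = [y-z]x≈yx-zx (v j) μ R
      maxIndex = maximalIndex ≤-refl ≤-trans total v
      minIndex = maximalIndex {_≼_ = flip _≤_} ≤-refl (flip ≤-trans) (flip total) v
      p = proj₁ maxIndex
      q = proj₁ minIndex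
      μvp≤Rvp : (μ * v p) ≤ (R * v p)
      μvp≤Rvp = ≲-respˡ-≈ (Av≈μv p)
        (≲-respʳ-≈ (*-congʳ (rowSum≈R p)) (∑-weighted-≤ (0≤A p) (proj₂ maxIndex)))
      Rvq≤μvq : (R * v q) ≤ (μ * v q)
      Rvq≤μvq = ≲-respʳ-≈ (Av≈μv q)
        (≲-respˡ-≈ (*-congʳ (rowSum≈R q)) (∑-weighted-≥ (0≤A q) (proj₂ minIndex)))
      0≤gap : 0# ≤ gap
      0≤gap = x≤y⇒0≤y-x R≤μ
      gapvᵢ≤0 : (gap * v i) ≤ 0#
      gapvᵢ≤0 = ≤-trans (*-monoˡ-≤-nonNeg 0≤gap (proj₂ maxIndex i))
                      (≲-respˡ-≈ (sym (gap*v≈μv-Rv p)) (x≤y⇒x-y≤0 μvp≤Rvp))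
      0≤gapvᵢ : 0# ≤ (gap * v i)
      0≤gapvᵢ = ≤-trans (≲-respʳ-≈ (sym (gap*v≈μv-Rv q)) (x≤y⇒0≤y-x Rvq≤μvq))
                      (*-monoˡ-≤-nonNeg 0≤gap (proj₂ minIndex i))

open import Data.Nat using (_^_; _*_; _+_; _≤_; _∸_)
open import Data.Product using (_×_)
open import Data.Nat.Properties using (m^n>0)
open import Data.Fin using (toℕ; fromℕ<)
import Relation.Binary.PropositionalEquality as ≡
open Weight using (weight; weightSum; weightSum-closedForm; sumBelow; sumBelow-shift; weight-periodic)

theorem3p20 :
  ∀ {c ℓ₁ ℓ₂ : Level} (F : OrderedField c ℓ₁ ℓ₂) (h : ℕ) → 1 ≤ h →
    let instance _ = 2^h-nonZero h in
    (d : Fin (2 ^ h) → Fin (2 ^ h) → ℕ) → IsMCDistance 2 h d →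
    ∃[ ρ ] (IsLargestEigenvalue F (λ x y → fromℕ F (d x y)) ρ
            × OrderedField._≈_ F (OrderedField._*_ F (fromℕ F 9) ρ)
                (OrderedField._-_ F (fromℕ F ((2 ^ h) * (3 * h + 1)))
                   (pow F (OrderedField.-_ F (OrderedField.1# F)) h)))
theorem3p20 F h _ d isDistance =
  fromℕ F (weightSum h) ,
  constantRowSum⇒isLargestEigenvalue (λ x y → fromℕ F (d x y)) (fromℕ< (m^n>0 2 h))
    (λ x y → 0≤fromℕ (d x y)) rowSum ,
  9s+e≡E+o⇒9s≈E-[-1]^h {weightSum h} h (weightSum-closedForm h)
  where
  open OrderedField F using (_≈_; setoid; reflexive)
  open OrderedFieldProperties F
  open Distance h using (N; δ-isDistance)
  open import Relation.Binary.Reasoning.Setoid setoid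

  rowSum : ∀ x → ∑ F (λ y → fromℕ F (d x y)) ≈ fromℕ F (weightSum h)
  rowSum x = begin
    ∑ F (λ y → fromℕ F (d x y))
      ≈⟨ ∑-cong (λ y → reflexive (≡.cong (fromℕ F) (δ-isDistance d isDistance x y))) ⟩
    ∑ F (λ (y : Fin N) → fromℕ F (weight h (toℕ y + (N ∸ toℕ x))))
      ≈⟨ ∑-fromℕ N (λ n → weight h (n + (N ∸ toℕ x))) ⟩
    fromℕ F (sumBelow N (λ n → weight h (n + (N ∸ toℕ x))))
      ≡⟨ ≡.cong (fromℕ F) (sumBelow-shift N (weight h) (weight-periodic h) (N ∸ toℕ x)) ⟩
    fromℕ F (weightSum h) ∎
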